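{- Suppose there is a polynomial $Q$ such that every graph on $n$ vertices has a CS-separator of size at most $Q(n)$. Then there is a polynomial $P$ such that for every graph $G$ and every list assignment $\mathcal L:V(G)\to\mathcal P(\{A_1,A_2,A_3,A_4\})$ there is a 2-list covering for the stubborn problem on $(G,\mathcal L)$ of size at most $P(|V(G)|)$.
   Context: Stubborn problem: an instance is a graph $G=(V,E)$ with a list assignment $\mathcal L:V\to\mathcal P(\{A_1,A_2,A_3,A_4\})$; a solution is a partition of $V$ into (possibly empty) sets $A_1,\dots,A_4$ such that $A_4$ is a clique, $A_1$ and $A_2$ are stable sets, there is no edge between $A_1$ and $A_3$, and each vertex $v$ lies in some $A_i$ with $A_i\in\mathcal L(v)$. A solution is maximal if no $v\in A_1$ satisfies $A_3\in\mathcal L(v)$. A 2-list assignment assigns to each vertex a set of at most two of $A_1,\dots,A_4$; it is compatible with a solution if each vertex's part belongs to its set. A 2-list covering for the stubborn problem on $(G,\mathcal L)$ is a set of 2-list assignments such that every maximal solution is compatible with at least one of them. A cut of $G=(V,E)$ is a pair $(U,W)$ with $U\cup W=V$, $U\cap W=\emptyset$; it separates a clique $K$ and a stable set $S$ if $K\subseteq U$, $S\subseteq W$; a CS-separator is a family of cuts separating every clique from every stable set disjoint from it. -}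

module Defs where

open import Data.Nat using (ℕ; zero; suc; _+_; _*_; _≤_)
open import Data.Fin using (Fin)
import Data.Fin as Fin
open import Data.Bool using (Bool; true; false; T; not)
open import Data.List using (List; []; _∷_; length; filter; allFin)
open import Data.Bool.Properties using (T?)
open import Data.List.Membership.Propositional using (_∈_)
open import Data.List.Relation.Unary.Any using (Any)
open import Data.Product using (_×_; Σ; ∃)
open import Data.Empty using (⊥)
open import Relation.Binary.PropositionalEquality using (_≡_; _≢_)
open import Relation.Nullary using (¬_)

-- Polynomials with natural-number coefficients (coefficient list,
-- constant term first), evaluated at a natural number.

Poly : Set
Poly = List ℕ

eval : Poly → ℕ → ℕ
eval []       x = 0
eval (c ∷ cs) x = c + x * eval cs x

record Graph (n : ℕ) : Set where
  field
    adj     : Fin n → Fin n → Bool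
    sym     : ∀ u v → adj u v ≡ adj v u
    irrefl  : ∀ v → adj v v ≡ false

open Graph public

VSet : ℕ → Set
VSet n = Fin n → Bool

_∈ᵥ_ : ∀ {n} → Fin n → VSet n → Set
v ∈ᵥ X = T (X v)

IsClique : ∀ {n} → Graph n → VSet n → Set
IsClique G K = ∀ u v → u ∈ᵥ K → v ∈ᵥ K → u ≢ v → T (adj G u v)

IsStable : ∀ {n} → Graph n → VSet n → Set
IsStable G S = ∀ u v → u ∈ᵥ S → v ∈ᵥ S → ¬ T (adj G u v)

Disjoint : ∀ {n} → VSet n → VSet n → Set
Disjoint X Y = ∀ v → v ∈ᵥ X → ¬ (v ∈ᵥ Y)

-- Cuts and CS-separators.
-- A cut (U , W) with U ∪ W = V, U ∩ W = ∅ is determined by U;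
-- W is the complement of U.

Cut : ℕ → Set
Cut n = VSet n

Separates : ∀ {n} → Cut n → VSet n → VSet n → Set
Separates U K S = (∀ v → v ∈ᵥ K → v ∈ᵥ U) × (∀ v → v ∈ᵥ S → ¬ (v ∈ᵥ U))

IsCSSeparator : ∀ {n} → Graph n → List (Cut n) → Set
IsCSSeparator G F =
  ∀ (K S : VSet _) → IsClique G K → IsStable G S → Disjoint K S →
  Any (λ U → Separates U K S) F

Part : Set
Part = Fin 4

A₁ A₂ A₃ A₄ : Part
A₁ = Fin.zero
A₂ = Fin.suc Fin.zero
A₃ = Fin.suc (Fin.suc Fin.zero)
A₄ = Fin.suc (Fin.suc (Fin.suc Fin.zero))

ListAssignment : ℕ → Set
ListAssignment n = Fin n → Part → Bool

-- A partition of V into (possibly empty) A₁,…,A₄ is a map V → Part.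
Partition : ℕ → Set
Partition n = Fin n → Part

IsSolution : ∀ {n} → Graph n → ListAssignment n → Partition n → Set
IsSolution G L σ =
    (∀ u v → σ u ≡ A₄ → σ v ≡ A₄ → u ≢ v → T (adj G u v))
  × (∀ u v → σ u ≡ A₁ → σ v ≡ A₁ → ¬ T (adj G u v))
  × (∀ u v → σ u ≡ A₂ → σ v ≡ A₂ → ¬ T (adj G u v))
  × (∀ u v → σ u ≡ A₁ → σ v ≡ A₃ → ¬ T (adj G u v))
  × (∀ v → T (L v (σ v)))

IsMaximalSolution : ∀ {n} → Graph n → ListAssignment n → Partition n → Set
IsMaximalSolution G L σ =
  IsSolution G L σ × (∀ v → σ v ≡ A₁ → ¬ T (L v A₃))

count : (Part → Bool) → ℕ
count X = length (filter (λ i → T? (X i)) (allFin 4))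

record TwoListAssignment (n : ℕ) : Set where
  field
    lists   : Fin n → Part → Bool
    atMost2 : ∀ v → count (lists v) ≤ 2

open TwoListAssignment public

CompatibleWith : ∀ {n} → TwoListAssignment n → Partition n → Set
CompatibleWith M σ = ∀ v → T (lists M v (σ v))

IsTwoListCovering : ∀ {n} → Graph n → ListAssignment n →
                    List (TwoListAssignment n) → Set
IsTwoListCovering G L 𝓜 =
  ∀ σ → IsMaximalSolution G L σ → Any (λ M → CompatibleWith M σ) 𝓜

-- Fix a CS-separator F.  For a maximal solution, A₄ is a clique and A₁, A₂
-- are stable sets disjoint from it, so some cut U₁ ∈ F separates A₄ from A₁
-- and some U₂ ∈ F separates A₄ from A₂.  The two bits "v ∈ U₁", "v ∈ U₂",
-- together with the bit "A₃ ∈ 𝓛(v)" (which is false on A₁ by maximality and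
-- true on A₃), leave at most two possible parts for each vertex v.  Hence the
-- |F|² pairs of cuts yield a 2-list covering, of size at most Q(n)².
module Submission where

open import Defs hiding (sym)
open import Data.Nat using (ℕ; _≤_; _+_; _*_)
open import Data.Nat.Properties using (≤-refl; *-mono-≤; +-identityʳ; *-zeroʳ)
open import Data.Nat.Tactic.RingSolver using (solve-∀)
open import Data.List using (List; []; _∷_; length; map; cartesianProductWith)
open import Data.List.Properties using (length-++; length-map)
open import Data.List.Relation.Unary.Any.Properties using (cartesianProductWith⁺)
open import Data.Product using (Σ; _×_; _,_)
open import Data.Bool using (Bool; true; false; T; _∨_)
open import Data.Empty using (⊥-elim)
open import Data.Fin using (zero; suc)
open import Data.Fin.Properties using (_≟_)
open import Relation.Nullary using (¬_)
open import Relation.Nullary.Decidable using (⌊_⌋; toWitness; fromWitness)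
open import Relation.Binary.PropositionalEquality
  using (_≡_; _≢_; refl; sym; trans; cong; cong₂; subst; module ≡-Reasoning)

infixl 6 _+ₚ_
infixl 7 _*ₚ_ _·ₚ_

_+ₚ_ : Poly → Poly → Poly
[]       +ₚ q        = q
(a ∷ as) +ₚ []       = a ∷ as
(a ∷ as) +ₚ (b ∷ bs) = a + b ∷ as +ₚ bs

_·ₚ_ : ℕ → Poly → Poly
c ·ₚ []       = []
c ·ₚ (d ∷ ds) = c * d ∷ c ·ₚ ds

_*ₚ_ : Poly → Poly → Poly
[]       *ₚ q = []
(c ∷ cs) *ₚ q = c ·ₚ q +ₚ (0 ∷ cs *ₚ q)

eval-+ₚ : ∀ p q x → eval (p +ₚ q) x ≡ eval p x + eval q x
eval-+ₚ []       q        x = refl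
eval-+ₚ (a ∷ as) []       x = sym (+-identityʳ _)
eval-+ₚ (a ∷ as) (b ∷ bs) x = begin
  a + b + x * eval (as +ₚ bs) x       ≡⟨ cong (λ t → a + b + x * t) (eval-+ₚ as bs x) ⟩
  a + b + x * (eval as x + eval bs x) ≡⟨ shuffle a b x (eval as x) (eval bs x) ⟩
  a + x * eval as x + (b + x * eval bs x) ∎
  where
  shuffle : ∀ a b x u v → a + b + x * (u + v) ≡ a + x * u + (b + x * v)
  shuffle = solve-∀
  open ≡-Reasoning

eval-·ₚ : ∀ c p x → eval (c ·ₚ p) x ≡ c * eval p x
eval-·ₚ c []       x = sym (*-zeroʳ c)
eval-·ₚ c (d ∷ ds) x = begin
  c * d + x * eval (c ·ₚ ds) x ≡⟨ cong (λ t → c * d + x * t) (eval-·ₚ c ds x) ⟩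
  c * d + x * (c * eval ds x)  ≡⟨ factor c d x (eval ds x) ⟩
  c * (d + x * eval ds x)      ∎
  where
  factor : ∀ c d x u → c * d + x * (c * u) ≡ c * (d + x * u)
  factor = solve-∀
  open ≡-Reasoning

eval-*ₚ : ∀ p q x → eval (p *ₚ q) x ≡ eval p x * eval q x
eval-*ₚ []       q x = refl
eval-*ₚ (c ∷ cs) q x = begin
  eval (c ·ₚ q +ₚ (0 ∷ cs *ₚ q)) x          ≡⟨ eval-+ₚ (c ·ₚ q) (0 ∷ cs *ₚ q) x ⟩
  eval (c ·ₚ q) x + (0 + x * eval (cs *ₚ q) x)
    ≡⟨ cong₂ (λ s t → s + (0 + x * t)) (eval-·ₚ c q x) (eval-*ₚ cs q x) ⟩
  c * eval q x + (0 + x * (eval cs x * eval q x)) ≡⟨ factor c x (eval cs x) (eval q x) ⟩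
  (c + x * eval cs x) * eval q x            ∎
  where
  factor : ∀ c x u w → c * w + (0 + x * (u * w)) ≡ (c + x * u) * w
  factor = solve-∀
  open ≡-Reasoning

length-cartesianProductWith : ∀ {A B C : Set} (f : A → B → C) xs ys →
  length (cartesianProductWith f xs ys) ≡ length xs * length ys
length-cartesianProductWith f []       ys = refl
length-cartesianProductWith f (x ∷ xs) ys =
  trans (length-++ (map (f x) ys))
        (cong₂ _+_ (length-map (f x) ys) (length-cartesianProductWith f xs ys))

part : ∀ {n} → Partition n → Part → VSet n
part σ a v = ⌊ σ v ≟ a ⌋

module _ {n} (G : Graph n) (σ : Partition n) where

  part-clique : ∀ {a} → (∀ u v → σ u ≡ a → σ v ≡ a → u ≢ v → T (adj G u v)) →
                IsClique G (part σ a)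
  part-clique clique u v u∈ v∈ = clique u v (toWitness u∈) (toWitness v∈)

  part-stable : ∀ {a} → (∀ u v → σ u ≡ a → σ v ≡ a → ¬ T (adj G u v)) →
                IsStable G (part σ a)
  part-stable stable u v u∈ v∈ = stable u v (toWitness u∈) (toWitness v∈)

part-disjoint : ∀ {n} (σ : Partition n) {a b} → a ≢ b → Disjoint (part σ a) (part σ b)
part-disjoint σ a≢b v v∈a v∈b = a≢b (trans (sym (toWitness v∈a)) (toWitness v∈b))

Distinguishes : Part → Part → Bool → Part → Set
Distinguishes a b u p = (p ≡ a → T u) × (p ≡ b → ¬ T u)

separates⇒distinguishes : ∀ {n} (σ : Partition n) {a b} {U : Cut n} →
  Separates U (part σ a) (part σ b) → ∀ v → Distinguishes a b (U v) (σ v)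
separates⇒distinguishes σ (a⊆U , b∩U=∅) v =
  (λ σv≡a → a⊆U v (fromWitness σv≡a)) , (λ σv≡b → b∩U=∅ v (fromWitness σv≡b))

maximal⇒distinguishes : ∀ {n} (G : Graph n) (L : ListAssignment n) {σ} →
  IsMaximalSolution G L σ → ∀ v → Distinguishes A₃ A₁ (L v A₃) (σ v)
maximal⇒distinguishes G L ((_ , _ , _ , _ , respects) , maximal) v =
  (λ σv≡A₃ → subst (λ p → T (L v p)) σv≡A₃ (respects v)) , maximal v

⁅_,_⁆ : Part → Part → Part → Bool
⁅ a , b ⁆ p = ⌊ p ≟ a ⌋ ∨ ⌊ p ≟ b ⌋

candidates : (inU₁ inU₂ A₃∈L : Bool) → Part → Bool
candidates false false false = ⁅ A₁ , A₂ ⁆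
candidates false false true  = ⁅ A₂ , A₃ ⁆
candidates false true  _     = ⁅ A₁ , A₃ ⁆
candidates true  false _     = ⁅ A₂ , A₃ ⁆
candidates true  true  _     = ⁅ A₃ , A₄ ⁆

candidates-atMost2 : ∀ u₁ u₂ ℓ₃ → count (candidates u₁ u₂ ℓ₃) ≤ 2
candidates-atMost2 false false false = ≤-refl
candidates-atMost2 false false true  = ≤-refl
candidates-atMost2 false true  _     = ≤-refl
candidates-atMost2 true  false _     = ≤-refl
candidates-atMost2 true  true  _     = ≤-refl

candidates-complete : ∀ p {u₁ u₂ ℓ₃} →
  Distinguishes A₄ A₁ u₁ p → Distinguishes A₄ A₂ u₂ p → Distinguishes A₃ A₁ ℓ₃ p →
  T (candidates u₁ u₂ ℓ₃ p)
candidates-complete zero {true} (_ , A₁∉U₁) _ _ = ⊥-elim (A₁∉U₁ refl _)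
candidates-complete zero {false} {_} {true} _ _ (_ , A₃∉L) = ⊥-elim (A₃∉L refl _)
candidates-complete zero {false} {false} {false} _ _ _ = _
candidates-complete zero {false} {true}  {false} _ _ _ = _
candidates-complete (suc zero) {_} {true} _ (_ , A₂∉U₂) _ = ⊥-elim (A₂∉U₂ refl _)
candidates-complete (suc zero) {false} {false} {false} _ _ _ = _
candidates-complete (suc zero) {false} {false} {true}  _ _ _ = _
candidates-complete (suc zero) {true}  {false}         _ _ _ = _
candidates-complete (suc (suc zero)) {_} {_} {false} _ _ (A₃∈L , _) = ⊥-elim (A₃∈L refl)
candidates-complete (suc (suc zero)) {false} {false} {true} _ _ _ = _
candidates-complete (suc (suc zero)) {false} {true}  {true} _ _ _ = _
candidates-complete (suc (suc zero)) {true}  {false} {true} _ _ _ = _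
candidates-complete (suc (suc zero)) {true}  {true}  {true} _ _ _ = _
candidates-complete (suc (suc (suc zero))) {false} (A₄∈U₁ , _) _ _ = ⊥-elim (A₄∈U₁ refl)
candidates-complete (suc (suc (suc zero))) {true} {false} _ (A₄∈U₂ , _) _ = ⊥-elim (A₄∈U₂ refl)
candidates-complete (suc (suc (suc zero))) {true} {true} _ _ _ = _

twoListAssignment : ∀ {n} → ListAssignment n → Cut n → Cut n → TwoListAssignment n
twoListAssignment L U₁ U₂ = record
  { lists   = λ v → candidates (U₁ v) (U₂ v) (L v A₃)
  ; atMost2 = λ v → candidates-atMost2 (U₁ v) (U₂ v) (L v A₃) }

separator⇒covering : ∀ {n} (G : Graph n) (L : ListAssignment n) {F : List (Cut n)} →
  IsCSSeparator G F → IsTwoListCovering G L (cartesianProductWith (twoListAssignment L) F F)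
separator⇒covering G L separator σ maximal@((clique , stable₁ , stable₂ , _) , _) =
  cartesianProductWith⁺ (twoListAssignment L) compatible
    (separator (part σ A₄) (part σ A₁) A₄-clique (part-stable G σ stable₁) (part-disjoint σ λ ()))
    (separator (part σ A₄) (part σ A₂) A₄-clique (part-stable G σ stable₂) (part-disjoint σ λ ()))
  where
  A₄-clique : IsClique G (part σ A₄)
  A₄-clique = part-clique G σ clique

  compatible : ∀ {U₁ U₂} → Separates U₁ (part σ A₄) (part σ A₁) →
    Separates U₂ (part σ A₄) (part σ A₂) → CompatibleWith (twoListAssignment L U₁ U₂) σ
  compatible sep₁ sep₂ v = candidates-complete (σ v)
    (separates⇒distinguishes σ sep₁ v) (separates⇒distinguishes σ sep₂ v)
    (maximal⇒distinguishes G L maximal v)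

lemma29 : (Σ Poly λ Q → (n : ℕ) (G : Graph n) →
               Σ (List (Cut n)) λ F → IsCSSeparator G F × length F ≤ eval Q n) →
            Σ Poly λ P → (n : ℕ) (G : Graph n) (L : ListAssignment n) →
              Σ (List (TwoListAssignment n)) λ 𝓜 →
                IsTwoListCovering G L 𝓜 × length 𝓜 ≤ eval P n
lemma29 (Q , smallSeparator) = Q *ₚ Q , λ n G L →
  let (F , separator , |F|≤Q) = smallSeparator n G
      𝓜 = cartesianProductWith (twoListAssignment L) F F
  in 𝓜 , separator⇒covering G L separator , (begin
       length 𝓜            ≡⟨ length-cartesianProductWith (twoListAssignment L) F F ⟩
       length F * length F ≤⟨ *-mono-≤ |F|≤Q |F|≤Q ⟩
       eval Q n * eval Q n ≡⟨ sym (eval-*ₚ Q Q n) ⟩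
       eval (Q *ₚ Q) n     ∎)
  where open Data.Nat.Properties.≤-Reasoning
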